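{- Suppose $P$ is a $2$-chain with $n$ elements, and write $P=\mathcal{Q}(n_1)\mathbin{\square}\cdots\mathbin{\square}\mathcal{Q}(n_s)$ with $n_1,\dots,n_s\geq 3$ and $n_1+\dots+n_s=n+2s-2$. If $n_1=\dots=n_s=3$ (so that $s=n-2$), then $l(P)=n$. Otherwise, let $r\leq s$ be maximal such that $n_r\geq 4$. Then \[ l(P)=l\bigl(\mathcal{Q}(n_1)\mathbin{\square}\cdots\mathbin{\square}\mathcal{Q}(n_{s-1})\mathbin{\square}\mathcal{Q}(n_s-1)\bigr)+l\bigl(\mathcal{Q}(n_1)\mathbin{\square}\cdots\mathbin{\square}\mathcal{Q}(n_{r-1})\mathbin{\square}\mathcal{Q}(n_r-2)\bigr). \]
   Context: All posets are finite; partial orders are written $\preceq$. A poset $(P,\preceq)$ is a $2$-chain if (1) there is a unique way to write $P$ as the union of two chains, and (2) $\preceq$ is maximal subject to (1), i.e. for every proper refinement $\preceq^+$ of $\preceq$ there is more than one way to write $P$ as the union of two $\preceq^+$-chains. $l(P)$ is the number of linear extensions of $P$ (total orders refining $\preceq$). $\mathcal{Q}(m)=\{1,\dots,m\}$ with $i\prec j$ iff $i\leq j-2$. Every $2$-chain with $n\ge3$ elements is isomorphic to such a splice for a unique choice of $n_1,\dots,n_s$. Splice: if $P$ has exactly two maximal elements $p_0,p_1$ with only $p_0$ supermaximal (above all non-maximal elements), and $Q$ has exactly two minimal elements $q_0,q_1$ with only $q_0$ superminimal, then $P\mathbin{\square}Q$ is obtained from $P\sqcup Q$ (orders within $P$,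 $Q$ unchanged; for $a\in P$, $b\in Q$: $a\preceq b$ iff $a\preceq p_i$ and $q_i\preceq b$ for some $i\in\{0,1\}$; no element of $Q$ below an element of $P$) by identifying $p_0$ with $q_0$ and $p_1$ with $q_1$. -}

module Defs where

open import Data.Nat using (ℕ; zero; suc; _+_; _∸_; _≤ᵇ_)
open import Data.Bool using (Bool; true; false; _∧_; _∨_; not; if_then_else_)
open import Data.Fin using (Fin; zero; suc; toℕ; splitAt; _↑ˡ_; _↑ʳ_)
open import Data.Fin.Properties using (_≟_)
open import Data.Sum using (inj₁; inj₂)
open import Data.Maybe using (Maybe; just; nothing)
open import Data.List using (List; []; _∷_; [_]; map; concatMap; foldl; length; filter; allFin)
open import Data.Bool.ListAction using (all)
open import Data.Vec using (Vec; []; _∷_; lookup)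
open import Relation.Nullary using (does)
open import Relation.Nullary.Decidable using (T?)

-- Finite posets on Fin N, given by a Boolean relation (x ≼ y),
-- together with two designated maximal elements p₀ (supermaximal) and p₁,
-- so that they can serve as the left factor of a splice.

record SPoset : Set where
  field
    size : ℕ
    rel  : Fin size → Fin size → Bool
    top₀ : Fin size
    top₁ : Fin size
open SPoset public

_==_ : ∀ {n} → Fin n → Fin n → Bool
x == y = does (x ≟ y)

-- Q(m) = {1,…,m}, i ≺ j iff i ≤ j − 2.  We write m = 2 + k and
-- label the element v ∈ {1,…,m} by the index v − 1 ∈ Fin (2 + k).
-- Minimal elements: q₀ = 1 (index 0, superminimal), q₁ = 2 (index 1).
-- Maximal elements: p₀ = m (index k+1, supermaximal), p₁ = m−1 (index k).

relQ : ∀ k → Fin (2 + k) → Fin (2 + k) → Bool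
relQ k i j = (i == j) ∨ (2 + toℕ i ≤ᵇ toℕ j)

lastQ : ∀ k → Fin (2 + k)
lastQ zero    = suc zero
lastQ (suc k) = suc (lastQ k)

penQ : ∀ k → Fin (2 + k)
penQ zero    = zero
penQ (suc k) = suc (penQ k)

Q′ : ℕ → SPoset                      -- Q′ k = Q(k + 2)
Q′ k = record { size = 2 + k ; rel = relQ k ; top₀ = lastQ k ; top₁ = penQ k }

Q : ℕ → SPoset                       -- Q(m), meaningful for m ≥ 2
Q m = Q′ (m ∸ 2)

-- Carrier Fin (size P + k): the first size P elements are those of P
-- (with p₀ ≡ q₀ and p₁ ≡ q₁ identified), the last k are the elements
-- 3,…,k+2 of Q(k+2).  For representatives x,y of the glued set,
-- x ≼ y iff  both lie in P and x ≼_P y, or both lie in Q and x ≼_Q y,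
-- or x ∈ P, y ∈ Q and x ≼ p_i, q_i ≼ y for some i ∈ {0,1}.

spliceQ : SPoset → ℕ → SPoset
spliceQ P k = record { size = N + k ; rel = r ; top₀ = fromQ (lastQ k) ; top₁ = fromQ (penQ k) }
  where
  N = size P
  R = rel P
  p₀ = top₀ P
  p₁ = top₁ P
  RQ = relQ k

  toP : Fin (N + k) → Maybe (Fin N)
  toP x with splitAt N x
  ... | inj₁ a = just a
  ... | inj₂ _ = nothing

  toQ : Fin (N + k) → Maybe (Fin (2 + k))
  toQ x with splitAt N x
  ... | inj₁ a = if a == p₀ then just zero else (if a == p₁ then just (suc zero) else nothing)
  ... | inj₂ j = just (suc (suc j))

  fromQ : Fin (2 + k) → Fin (N + k)
  fromQ zero          = p₀ ↑ˡ k
  fromQ (suc zero)    = p₁ ↑ˡ k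
  fromQ (suc (suc j)) = N ↑ʳ j

  bothP : Maybe (Fin N) → Maybe (Fin N) → Bool
  bothP (just a) (just b) = R a b
  bothP _        _        = false

  bothQ : Maybe (Fin (2 + k)) → Maybe (Fin (2 + k)) → Bool
  bothQ (just a) (just b) = RQ a b
  bothQ _        _        = false

  cross : Maybe (Fin N) → Maybe (Fin (2 + k)) → Bool
  cross (just a) (just b) = (R a p₀ ∧ RQ zero b) ∨ (R a p₁ ∧ RQ (suc zero) b)
  cross _        _        = false

  r : Fin (N + k) → Fin (N + k) → Bool
  r x y = bothP (toP x) (toP y) ∨ bothQ (toQ x) (toQ y) ∨ cross (toP x) (toQ y)

-- Q(n₁) □ Q(n₂) □ ⋯ □ Q(n_s)  (left-associated), for the list n₁ ∷ ⋯ ∷ n_s.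
-- (The empty list is never used; it is sent to the empty poset-like Q(2)-free value Q 0.)
splice : List ℕ → SPoset
splice []       = Q 0
splice (n ∷ ns) = foldl (λ P m → spliceQ P (m ∸ 2)) (Q n) ns

-- A total order refining ≼ on an N-element set is the
-- same as a bijection f : P → {0,…,N−1} with x ≼ y ⇒ f x ≤ f y.
-- We enumerate all maps Fin N → Fin N (as vectors) and count those which
-- are injective (hence bijective) and order-preserving.

allVecs : ∀ k n → List (Vec (Fin n) k)
allVecs zero    n = [ [] ]
allVecs (suc k) n = concatMap (λ i → map (i ∷_) (allVecs k n)) (allFin n)

allPairs : ∀ {N} → (Fin N → Fin N → Bool) → Bool
allPairs {N} f = all (λ x → all (λ y → f x y) (allFin N)) (allFin N)

isLinExt : (P : SPoset) → Vec (Fin (size P)) (size P) → Bool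
isLinExt P v =
  allPairs (λ x y → not (lookup v x == lookup v y) ∨ (x == y))
  ∧ allPairs (λ x y → not (rel P x y) ∨ (toℕ (lookup v x) ≤ᵇ toℕ (lookup v y)))

l : SPoset → ℕ
l P = length (filter (λ v → T? (isLinExt P v)) (allVecs (size P) (size P)))

-- Every linear extension ends in a maximal element, so l(P) is the sum of l(P − x)
-- over the maximal elements x of P.  A splice S = R □ Q(m), m ≥ 3, has exactly two
-- maximal elements, p₀ = m and p₁ = m − 1 of Q(m), and every element but p₁ lies below
-- p₀.  Hence l(S) = l(S − p₀) + l(S − p₁), and p₀ is the greatest element of S − p₁,
-- so l(S − p₁) = l(S − p₀ − p₁).  Deleting p₀ turns R □ Q(m) into R □ Q(m − 1), whose
-- top p₀ is the old p₁; so l(S − p₀) = l(R □ Q(m − 1)) and l(S − p₁) equals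
-- l(R □ Q(m − 1) − p₀), which is l(R □ Q(m − 2)) when m ≥ 4.  For m = 3 it is
-- l(R − p₁), because R □ Q(2) is R with p₀ and p₁ exchanged; so a trailing Q(3)
-- leaves l(− p₁) unchanged and adds it to l.  Applying this to the trailing Q(3)s and
-- then to Q(n_r) gives the recursion, and for n₁ = ⋯ = n_s = 3 every factor after
-- the first adds l(Q(3) − p₁) = 1 to l(Q(3)) = 3.

module Submission where

open import Defs
open import Algebra.Bundles using (CommutativeMonoid)
import Algebra.Properties.CommutativeMonoid.Sum
import Algebra.Properties.CommutativeSemigroup
open import Data.Bool using (Bool; true; false; _∧_; _∨_; not)
open import Data.Bool.ListAction using (all; and)
open import Data.Bool.Properties using (∧-commutativeMonoid; ∨-identityʳ; ∨-zeroʳ; ∧-zeroʳ; ∧-identityʳ; T-≡; ¬-not)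
open import Data.Empty using (⊥-elim)
open import Data.Fin using (Fin; zero; suc; toℕ; punchIn; punchOut; fromℕ; inject₁; cast; _≟_; _↑ˡ_; _↑ʳ_; splitAt; join)
open import Data.Fin.Properties as Fin
  using ( punchInᵢ≢i; punchIn-injective; punchIn-punchOut; punchOut-cong; toℕ<n; toℕ-fromℕ; ≤fromℕ
        ; injective⇒existsPivot; cast-is-id; splitAt-↑ˡ; splitAt-↑ʳ; join-splitAt; toℕ-injective
        ; ↑ʳ-injective; toℕ-cast; toℕ-↑ˡ; toℕ-↑ʳ; toℕ-inject₁ )
open import Data.List using (List; []; _∷_; _++_; _∷ʳ_; map; concatMap; length; filter; allFin; tabulate; foldl; replicate)
open import Data.List.Properties using (map-cong; map-∘; map-++; foldl-++; ++-assoc)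
open import Data.List.Relation.Unary.All using (All; []; _∷_)
open import Data.List.Relation.Unary.All.Properties using (++⁻ˡ; ∷ʳ⁻)
open import Data.Nat using (ℕ; zero; suc; _+_; _*_; _∸_; _≤ᵇ_; pred; _≤_; _<_; s≤s) renaming (_≟_ to _≟ℕ_)
open import Data.Nat.ListAction using (sum)
open import Data.Nat.ListAction.Properties using (sum-++)
open import Data.Nat.Properties
  using ( +-0-commutativeMonoid; +-identityʳ; +-suc; +-assoc; *-identityʳ; *-identityˡ; ≤⇒≤ᵇ; ≤ᵇ⇒≤
        ; <⇒≱; <⇒≤; ≤-refl; ≤-trans; ≤-pred; <-irrefl; ≤∧≢⇒<; m≤n⇒m≤1+n )
open import Data.Product using (∃; _×_; _,_)
open import Data.Sum using (_⊎_; inj₁; inj₂)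
open import Data.Vec using (Vec; []; _∷_; lookup; insertAt) renaming (map to vmap)
open import Data.Vec.Properties using (insertAt-lookup; insertAt-punchIn; lookup-map)
open import Function using (_∘_; id)
open import Function.Bundles using (Equivalence)
open import Relation.Binary.PropositionalEquality
open import Relation.Nullary using (yes; no)
open import Relation.Nullary.Decidable using (T?; dec-true; dec-false)

module ∑ℕ = Algebra.Properties.CommutativeMonoid.Sum +-0-commutativeMonoid
module ⋀ = Algebra.Properties.CommutativeMonoid.Sum ∧-commutativeMonoid
module ∧-Props = Algebra.Properties.CommutativeSemigroup (CommutativeMonoid.commutativeSemigroup ∧-commutativeMonoid)
open ∑ℕ using (sum-syntax)

𝟙 : Bool → ℕ
𝟙 true  = 1
𝟙 false = 0

-- Sums over Fin n and over all vectors

∑-zero : ∀ {n} (g : Fin n → ℕ) → (∀ i → g i ≡ 0) → ∑[ i < n ] g i ≡ 0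
∑-zero {n} g g≡0 = trans (∑ℕ.sum-cong-≗ g≡0) (∑ℕ.sum-replicate-zero n)

∑-single : ∀ {m} (a : Fin (suc m)) (g : Fin (suc m) → ℕ) →
  (∀ x → x ≢ a → g x ≡ 0) → ∑[ x < suc m ] g x ≡ g a
∑-single a g vanish = begin
  ∑ℕ.sum g                          ≡⟨ ∑ℕ.sum-remove {i = a} g ⟩
  g a + ∑ℕ.sum (g ∘ punchIn a)      ≡⟨ cong (g a +_) (∑-zero _ (λ j → vanish (punchIn a j) (punchInᵢ≢i a j))) ⟩
  g a + 0                           ≡⟨ +-identityʳ (g a) ⟩
  g a                               ∎
  where open ≡-Reasoning

∑-pair : ∀ {m} (a b : Fin (suc (suc m))) (g : Fin (suc (suc m)) → ℕ) → a ≢ b →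
  (∀ x → x ≢ a → x ≢ b → g x ≡ 0) → ∑[ x < suc (suc m) ] g x ≡ g a + g b
∑-pair a b g a≢b vanish = begin
  ∑ℕ.sum g                                ≡⟨ ∑ℕ.sum-remove {i = a} g ⟩
  g a + ∑ℕ.sum (g ∘ punchIn a)            ≡⟨ cong (g a +_) (∑-single b′ (g ∘ punchIn a) vanish′) ⟩
  g a + g (punchIn a b′)                  ≡⟨ cong (λ y → g a + g y) (punchIn-punchOut a≢b) ⟩
  g a + g b                               ∎
  where
  open ≡-Reasoning
  b′ = punchOut a≢b
  vanish′ : ∀ x → x ≢ b′ → g (punchIn a x) ≡ 0
  vanish′ x x≢b′ = vanish (punchIn a x) (punchInᵢ≢i a x)
    (λ eq → x≢b′ (punchIn-injective a x b′ (trans eq (sym (punchIn-punchOut a≢b)))))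

sum-map-cong : ∀ {A : Set} {f g : A → ℕ} → (∀ x → f x ≡ g x) → ∀ xs → sum (map f xs) ≡ sum (map g xs)
sum-map-cong f≗g xs = cong sum (map-cong f≗g xs)

sum-map-concatMap : ∀ {A B : Set} (f : B → ℕ) (h : A → List B) xs →
  sum (map f (concatMap h xs)) ≡ sum (map (λ a → sum (map f (h a))) xs)
sum-map-concatMap f h [] = refl
sum-map-concatMap f h (x ∷ xs) = begin
  sum (map f (h x ++ concatMap h xs))                 ≡⟨ cong sum (map-++ f (h x) _) ⟩
  sum (map f (h x) ++ map f (concatMap h xs))         ≡⟨ sum-++ (map f (h x)) _ ⟩
  sum (map f (h x)) + sum (map f (concatMap h xs))    ≡⟨ cong (sum (map f (h x)) +_) (sum-map-concatMap f h xs) ⟩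
  sum (map f (h x)) + sum (map (λ a → sum (map f (h a))) xs)  ∎
  where open ≡-Reasoning

sum-map-tabulate : ∀ {A : Set} {n} (g : A → ℕ) (h : Fin n → A) → sum (map g (tabulate h)) ≡ ∑[ i < n ] g (h i)
sum-map-tabulate {n = zero}  g h = refl
sum-map-tabulate {n = suc n} g h = cong (g (h zero) +_) (sum-map-tabulate g (h ∘ suc))

sum-map-∑ : ∀ {A : Set} {n} (g : Fin n → A → ℕ) xs →
  sum (map (λ v → ∑[ x < n ] g x v) xs) ≡ ∑[ x < n ] sum (map (g x) xs)
sum-map-∑ {n = n} g []       = sym (∑ℕ.sum-replicate-zero n)
sum-map-∑ {n = n} g (v ∷ xs) = trans (cong (∑[ x < n ] g x v +_) (sum-map-∑ g xs))
                                     (sym (∑ℕ.∑-distrib-+ (λ x → g x v) (λ x → sum (map (g x) xs))))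

length-filter : ∀ {A : Set} (b : A → Bool) xs → length (filter (λ v → T? (b v)) xs) ≡ sum (map (𝟙 ∘ b) xs)
length-filter b [] = refl
length-filter b (x ∷ xs) with b x
... | true  = cong suc (length-filter b xs)
... | false = length-filter b xs

sumVecs : ∀ k n → (Vec (Fin n) k → ℕ) → ℕ
sumVecs k n f = sum (map f (allVecs k n))

sumVecs-[] : ∀ n f → sumVecs 0 n f ≡ f []
sumVecs-[] n f = +-identityʳ (f [])

sumVecs-∷ : ∀ k n f → sumVecs (suc k) n f ≡ ∑[ i < n ] sumVecs k n (λ w → f (i ∷ w))
sumVecs-∷ k n f = begin
  sum (map f (concatMap (λ i → map (i ∷_) (allVecs k n)) (allFin n)))
    ≡⟨ sum-map-concatMap f _ (allFin n) ⟩
  sum (map (λ i → sum (map f (map (i ∷_) (allVecs k n)))) (allFin n))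
    ≡⟨ sum-map-cong (λ i → cong sum (sym (map-∘ (allVecs k n)))) (allFin n) ⟩
  sum (map (λ i → sumVecs k n (λ w → f (i ∷ w))) (tabulate id))
    ≡⟨ sum-map-tabulate (λ i → sumVecs k n (λ w → f (i ∷ w))) id ⟩
  ∑[ i < n ] sumVecs k n (λ w → f (i ∷ w))  ∎
  where open ≡-Reasoning

sumVecs-cong : ∀ k n {f g} → (∀ v → f v ≡ g v) → sumVecs k n f ≡ sumVecs k n g
sumVecs-cong k n f≗g = sum-map-cong f≗g (allVecs k n)

sumVecs-zero : ∀ k n (f : Vec (Fin n) k → ℕ) → (∀ v → f v ≡ 0) → sumVecs k n f ≡ 0
sumVecs-zero k n f f≡0 = go (allVecs k n)
  where
  go : ∀ vs → sum (map f vs) ≡ 0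
  go []       = refl
  go (v ∷ vs) = cong₂ _+_ (f≡0 v) (go vs)

sumVecs-∑ : ∀ k n {m} (g : Fin m → Vec (Fin n) k → ℕ) →
  sumVecs k n (λ v → ∑[ x < m ] g x v) ≡ ∑[ x < m ] sumVecs k n (g x)
sumVecs-∑ k n g = sum-map-∑ g (allVecs k n)

sumVecs-insertAt : ∀ k n (x : Fin (suc k)) (f : Vec (Fin n) (suc k) → ℕ) →
  sumVecs (suc k) n f ≡ ∑[ j < n ] sumVecs k n (λ w → f (insertAt w x j))
sumVecs-insertAt k       n zero    f = sumVecs-∷ k n f
sumVecs-insertAt (suc k) n (suc x) f = begin
  sumVecs (suc (suc k)) n f
    ≡⟨ sumVecs-∷ (suc k) n f ⟩
  ∑[ i < n ] sumVecs (suc k) n (λ w → f (i ∷ w))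
    ≡⟨ ∑ℕ.sum-cong-≗ (λ i → sumVecs-insertAt k n x (λ w → f (i ∷ w))) ⟩
  ∑[ i < n ] ∑[ j < n ] sumVecs k n (λ u → f (i ∷ insertAt u x j))
    ≡⟨ ∑ℕ.∑-comm (λ i j → sumVecs k n (λ u → f (i ∷ insertAt u x j))) ⟩
  ∑[ j < n ] ∑[ i < n ] sumVecs k n (λ u → f (i ∷ insertAt u x j))
    ≡⟨ ∑ℕ.sum-cong-≗ (λ j → sym (sumVecs-∷ k n (λ w → f (insertAt w (suc x) j)))) ⟩
  ∑[ j < n ] sumVecs (suc k) n (λ w → f (insertAt w (suc x) j))  ∎
  where open ≡-Reasoning

sumVecs-avoiding : ∀ k m (i : Fin (suc m)) (f : Vec (Fin (suc m)) k → ℕ) →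
  (∀ w p → lookup w p ≡ i → f w ≡ 0) → sumVecs k (suc m) f ≡ sumVecs k m (f ∘ vmap (punchIn i))
sumVecs-avoiding zero    m i f hits = trans (sumVecs-[] (suc m) f) (sym (sumVecs-[] m (f ∘ vmap (punchIn i))))
sumVecs-avoiding (suc k) m i f hits = begin
  sumVecs (suc k) (suc m) f
    ≡⟨ sumVecs-∷ k (suc m) f ⟩
  ∑[ j < suc m ] sumVecs k (suc m) (λ w → f (j ∷ w))
    ≡⟨ ∑ℕ.sum-remove {i = i} (λ j → sumVecs k (suc m) (λ w → f (j ∷ w))) ⟩
  sumVecs k (suc m) (λ w → f (i ∷ w)) + ∑[ j < m ] sumVecs k (suc m) (λ w → f (punchIn i j ∷ w))
    ≡⟨ cong₂ _+_ (sumVecs-zero k (suc m) _ (λ w → hits (i ∷ w) zero refl))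
                 (∑ℕ.sum-cong-≗ (λ j → sumVecs-avoiding k m i (λ w → f (punchIn i j ∷ w))
                                          (λ w p → hits (punchIn i j ∷ w) (suc p)))) ⟩
  ∑[ j < m ] sumVecs k m (λ u → f (punchIn i j ∷ vmap (punchIn i) u))
    ≡⟨ sym (sumVecs-∷ k m (f ∘ vmap (punchIn i))) ⟩
  sumVecs (suc k) m (f ∘ vmap (punchIn i))  ∎
  where open ≡-Reasoning

==-refl : ∀ {n} (a : Fin n) → (a == a) ≡ true
==-refl a = dec-true (a ≟ a) refl

==-false : ∀ {n} {a b : Fin n} → a ≢ b → (a == b) ≡ false
==-false {a = a} {b} a≢b = dec-false (a ≟ b) a≢b

==-sound : ∀ {n} {a b : Fin n} → (a == b) ≡ true → a ≡ b
==-sound {a = a} {b} eq with a ≟ b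
... | yes a≡b = a≡b

∧-true₁ : ∀ {a b} → (a ∧ b) ≡ true → a ≡ true
∧-true₁ {true} _ = refl

==-injective : ∀ {n m} (f : Fin n → Fin m) → (∀ a b → f a ≡ f b → a ≡ b) → ∀ a b → (f a == f b) ≡ (a == b)
==-injective f inj a b with a ≟ b
... | yes refl = ==-refl (f a)
... | no a≢b   = ==-false (a≢b ∘ inj a b)

==-toℕ : ∀ {n n′} (i j : Fin n) (i′ j′ : Fin n′) → toℕ i ≡ toℕ i′ → toℕ j ≡ toℕ j′ →
  (i == j) ≡ (i′ == j′)
==-toℕ i j i′ j′ i≈i′ j≈j′ with i ≟ j | i′ ≟ j′
... | yes refl | yes _    = refl
... | no _     | no _     = refl
... | yes refl | no i′≢j′ = ⊥-elim (i′≢j′ (toℕ-injective (trans (sym i≈i′) j≈j′)))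
... | no i≢j   | yes refl = ⊥-elim (i≢j (toℕ-injective (trans i≈i′ (sym j≈j′))))

≤ᵇ-true : ∀ {m n} → m ≤ n → (m ≤ᵇ n) ≡ true
≤ᵇ-true m≤n = Equivalence.to T-≡ (≤⇒≤ᵇ m≤n)

≤ᵇ-false : ∀ {m n} → n < m → (m ≤ᵇ n) ≡ false
≤ᵇ-false {m} {n} n<m = ¬-not (λ eq → <⇒≱ n<m (≤ᵇ⇒≤ m n (Equivalence.from T-≡ eq)))

⋀-elim : ∀ {n} (g : Fin n → Bool) → ⋀.sum g ≡ true → ∀ i → g i ≡ true
⋀-elim g eq zero    with g zero | eq
... | true | _ = refl
⋀-elim g eq (suc i) with g zero | eq
... | true | eq′ = ⋀-elim (g ∘ suc) eq′ i

⋀-intro : ∀ {n} (g : Fin n → Bool) → (∀ i → g i ≡ true) → ⋀.sum g ≡ true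
⋀-intro {zero}  g all = refl
⋀-intro {suc n} g all rewrite all zero = ⋀-intro (g ∘ suc) (all ∘ suc)

⋀-false : ∀ {n} (g : Fin (suc n) → Bool) i → g i ≡ false → ⋀.sum g ≡ false
⋀-false g i gi≡false = trans (⋀.sum-remove {i = i} g) (cong (_∧ ⋀.sum (g ∘ punchIn i)) gi≡false)

all-tabulate : ∀ {A : Set} {n} (g : A → Bool) (h : Fin n → A) → all g (tabulate h) ≡ ⋀.sum (g ∘ h)
all-tabulate {n = zero}  g h = refl
all-tabulate {n = suc n} g h = cong (g (h zero) ∧_) (all-tabulate g (h ∘ suc))

allPairs-⋀ : ∀ {N} (f : Fin N → Fin N → Bool) → allPairs f ≡ ⋀.sum (λ x → ⋀.sum (f x))
allPairs-⋀ {N} f = trans (cong and (map-cong (λ x → all-tabulate (f x) id) (allFin N)))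
                         (all-tabulate (λ x → ⋀.sum (f x)) id)

⋀²-split : ∀ {M} (x : Fin (suc M)) (f : Fin (suc M) → Fin (suc M) → Bool) →
  f x x ≡ true → (∀ a → f (punchIn x a) x ≡ true) →
  ⋀.sum (λ a → ⋀.sum (f a))
    ≡ ⋀.sum (λ b → f x (punchIn x b)) ∧ ⋀.sum (λ a → ⋀.sum (λ b → f (punchIn x a) (punchIn x b)))
⋀²-split x f fxx column = begin
  ⋀.sum (λ a → ⋀.sum (f a))
    ≡⟨ ⋀.sum-remove {i = x} (λ a → ⋀.sum (f a)) ⟩
  ⋀.sum (f x) ∧ ⋀.sum (λ a → ⋀.sum (f (punchIn x a)))
    ≡⟨ cong₂ _∧_ (⋀.sum-remove {i = x} (f x)) (⋀.sum-cong-≗ (λ a → ⋀.sum-remove {i = x} (f (punchIn x a)))) ⟩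
  (f x x ∧ ⋀.sum row) ∧ ⋀.sum (λ a → f (punchIn x a) x ∧ ⋀.sum (rest a))
    ≡⟨ cong₂ (λ p q → (p ∧ ⋀.sum row) ∧ q) fxx (⋀.sum-cong-≗ (λ a → cong (_∧ ⋀.sum (rest a)) (column a))) ⟩
  ⋀.sum row ∧ ⋀.sum (λ a → ⋀.sum (rest a))  ∎
  where
  open ≡-Reasoning
  row  = λ b → f x (punchIn x b)
  rest = λ a b → f (punchIn x a) (punchIn x b)

-- Linear extensions of a Boolean relation

BoolRel : ℕ → Set
BoolRel N = Fin N → Fin N → Bool

injectiveᵇ : ∀ {N} → Vec (Fin N) N → Bool
injectiveᵇ v = allPairs (λ x y → not (lookup v x == lookup v y) ∨ (x == y))

monotoneᵇ : ∀ {N} → BoolRel N → Vec (Fin N) N → Bool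
monotoneᵇ r v = allPairs (λ x y → not (r x y) ∨ (toℕ (lookup v x) ≤ᵇ toℕ (lookup v y)))

isLinExtᵇ : ∀ {N} → BoolRel N → Vec (Fin N) N → Bool
isLinExtᵇ r v = injectiveᵇ v ∧ monotoneᵇ r v

#linExt : ∀ N → BoolRel N → ℕ
#linExt N r = length (filter (λ v → T? (isLinExtᵇ r v)) (allVecs N N))

#linExt-sumVecs : ∀ N r → #linExt N r ≡ sumVecs N N (𝟙 ∘ isLinExtᵇ r)
#linExt-sumVecs N r = length-filter (isLinExtᵇ r) (allVecs N N)

allPairs-cong : ∀ {N} {f g : Fin N → Fin N → Bool} → (∀ x y → f x y ≡ g x y) → allPairs f ≡ allPairs g
allPairs-cong {f = f} {g} f≗g = begin
  allPairs f                        ≡⟨ allPairs-⋀ f ⟩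
  ⋀.sum (λ x → ⋀.sum (f x))         ≡⟨ ⋀.sum-cong-≗ (λ x → ⋀.sum-cong-≗ (f≗g x)) ⟩
  ⋀.sum (λ x → ⋀.sum (g x))         ≡⟨ allPairs-⋀ g ⟨
  allPairs g                        ∎
  where open ≡-Reasoning

#linExt-cong : ∀ N {r r′ : BoolRel N} → (∀ a b → r a b ≡ r′ a b) → #linExt N r ≡ #linExt N r′
#linExt-cong N {r} {r′} r≗r′ = begin
  #linExt N r                          ≡⟨ #linExt-sumVecs N r ⟩
  sumVecs N N (𝟙 ∘ isLinExtᵇ r)
    ≡⟨ sumVecs-cong N N (λ v → cong (λ b → 𝟙 (injectiveᵇ v ∧ b)) (monotone≡ v)) ⟩
  sumVecs N N (𝟙 ∘ isLinExtᵇ r′)       ≡⟨ #linExt-sumVecs N r′ ⟨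
  #linExt N r′                         ∎
  where
  open ≡-Reasoning
  monotone≡ : ∀ v → monotoneᵇ r v ≡ monotoneᵇ r′ v
  monotone≡ v = allPairs-cong (λ a b → cong (λ t → not t ∨ _) (r≗r′ a b))

injectiveᵇ-sound : ∀ {N} (v : Vec (Fin N) N) → injectiveᵇ v ≡ true → ∀ a b → lookup v a ≡ lookup v b → a ≡ b
injectiveᵇ-sound {N} v inj a b va≡vb = ==-sound (subst (λ t → not t ∨ (a == b) ≡ true) va==vb entry)
  where
  pair : Fin N → Fin N → Bool
  pair x y = not (lookup v x == lookup v y) ∨ (x == y)
  entry : pair a b ≡ true
  entry = ⋀-elim (pair a) (⋀-elim (λ x → ⋀.sum (pair x)) (trans (sym (allPairs-⋀ pair)) inj) a) b
  va==vb : (lookup v a == lookup v b) ≡ true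
  va==vb = trans (cong (lookup v a ==_) (sym va≡vb)) (==-refl (lookup v a))

injective⇒fromℕ-attained : ∀ {M} (f : Fin (suc M) → Fin (suc M)) → (∀ a b → f a ≡ f b → a ≡ b) →
  ∃ λ x → f x ≡ fromℕ M
injective⇒fromℕ-attained {M} f inj with injective⇒existsPivot (λ {a} {b} → inj a b) (fromℕ M)
... | x , _ , last≤fx = x , Fin.≤-antisym (≤fromℕ (f x)) last≤fx

positions-of-last : ∀ {M} (v : Vec (Fin (suc M)) (suc M)) → (∀ a b → lookup v a ≡ lookup v b → a ≡ b) →
  ∑[ x < suc M ] 𝟙 (lookup v x == fromℕ M) ≡ 1
positions-of-last {M} v inj with injective⇒fromℕ-attained (lookup v) inj
... | x₀ , vx₀≡last =
  trans (∑-single x₀ _ elsewhere) (cong 𝟙 (trans (cong (_== fromℕ M) vx₀≡last) (==-refl (fromℕ M))))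
  where
  elsewhere : ∀ x → x ≢ x₀ → 𝟙 (lookup v x == fromℕ M) ≡ 0
  elsewhere x x≢x₀ = cong 𝟙 (==-false (λ vx≡last → x≢x₀ (inj x x₀ (trans vx≡last (sym vx₀≡last)))))

isMaximal : ∀ {M} → BoolRel (suc M) → Fin (suc M) → Bool
isMaximal r x = ⋀.sum (λ b → not (r x (punchIn x b)))

deleteAt : ∀ {N} → Fin N → BoolRel N → BoolRel (pred N)
deleteAt {suc M} x r a b = r (punchIn x a) (punchIn x b)

placeLast : ∀ {M} → Fin (suc M) → Vec (Fin M) M → Vec (Fin (suc M)) (suc M)
placeLast {M} x u = insertAt (vmap (punchIn (fromℕ M)) u) x (fromℕ M)

toℕ-punchIn-fromℕ : ∀ {M} (a : Fin M) → toℕ (punchIn (fromℕ M) a) ≡ toℕ a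
toℕ-punchIn-fromℕ {suc M} zero    = refl
toℕ-punchIn-fromℕ {suc M} (suc a) = cong suc (toℕ-punchIn-fromℕ a)

punchIn-fromℕ-< : ∀ {M} (a : Fin M) → toℕ (punchIn (fromℕ M) a) < toℕ (fromℕ M)
punchIn-fromℕ-< {M} a rewrite toℕ-punchIn-fromℕ a | toℕ-fromℕ M = toℕ<n a

lookup-placeLast-punchIn : ∀ {M} (x : Fin (suc M)) u a →
  lookup (placeLast x u) (punchIn x a) ≡ punchIn (fromℕ M) (lookup u a)
lookup-placeLast-punchIn {M} x u a = trans (insertAt-punchIn _ x _ a) (lookup-map a (punchIn (fromℕ M)) u)

injectiveᵇ-placeLast : ∀ {M} (x : Fin (suc M)) u → injectiveᵇ (placeLast x u) ≡ injectiveᵇ u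
injectiveᵇ-placeLast {M} x u = begin
  allPairs f
    ≡⟨ allPairs-⋀ f ⟩
  ⋀.sum (λ a → ⋀.sum (f a))
    ≡⟨ ⋀²-split x f diagonal column ⟩
  ⋀.sum (λ b → f x (punchIn x b)) ∧ ⋀.sum (λ a → ⋀.sum (λ b → f (punchIn x a) (punchIn x b)))
    ≡⟨ cong₂ _∧_ (⋀-intro _ row) (⋀.sum-cong-≗ (λ a → ⋀.sum-cong-≗ (rest a))) ⟩
  ⋀.sum (λ a → ⋀.sum (g a))
    ≡⟨ allPairs-⋀ g ⟨
  allPairs g  ∎
  where
  open ≡-Reasoning
  v = placeLast x u
  last = fromℕ M
  f : BoolRel (suc M)
  f a b = not (lookup v a == lookup v b) ∨ (a == b)
  g : BoolRel M
  g a b = not (lookup u a == lookup u b) ∨ (a == b)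
  diagonal : f x x ≡ true
  diagonal = trans (cong (not (lookup v x == lookup v x) ∨_) (==-refl x)) (∨-zeroʳ _)
  column : ∀ a → f (punchIn x a) x ≡ true
  column a rewrite insertAt-lookup (vmap (punchIn last) u) x last | lookup-placeLast-punchIn x u a
    = cong (λ t → not t ∨ _) (==-false (punchInᵢ≢i last (lookup u a)))
  row : ∀ b → f x (punchIn x b) ≡ true
  row b rewrite insertAt-lookup (vmap (punchIn last) u) x last | lookup-placeLast-punchIn x u b
    = cong (λ t → not t ∨ _) (==-false (punchInᵢ≢i last (lookup u b) ∘ sym))
  rest : ∀ a b → f (punchIn x a) (punchIn x b) ≡ g a b
  rest a b rewrite lookup-placeLast-punchIn x u a | lookup-placeLast-punchIn x u b
                 | ==-injective (punchIn last) (punchIn-injective last) (lookup u a) (lookup u b)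
                 | ==-injective (punchIn x) (punchIn-injective x) a b = refl

monotoneᵇ-placeLast : ∀ {M} (r : BoolRel (suc M)) (x : Fin (suc M)) u →
  monotoneᵇ r (placeLast x u) ≡ isMaximal r x ∧ monotoneᵇ (deleteAt x r) u
monotoneᵇ-placeLast {M} r x u = begin
  allPairs f
    ≡⟨ allPairs-⋀ f ⟩
  ⋀.sum (λ a → ⋀.sum (f a))
    ≡⟨ ⋀²-split x f diagonal column ⟩
  ⋀.sum (λ b → f x (punchIn x b)) ∧ ⋀.sum (λ a → ⋀.sum (λ b → f (punchIn x a) (punchIn x b)))
    ≡⟨ cong₂ _∧_ (⋀.sum-cong-≗ row) (⋀.sum-cong-≗ (λ a → ⋀.sum-cong-≗ (rest a))) ⟩
  isMaximal r x ∧ ⋀.sum (λ a → ⋀.sum (g a))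
    ≡⟨ cong (isMaximal r x ∧_) (allPairs-⋀ g) ⟨
  isMaximal r x ∧ allPairs g  ∎
  where
  open ≡-Reasoning
  v = placeLast x u
  last = fromℕ M
  f : BoolRel (suc M)
  f a b = not (r a b) ∨ (toℕ (lookup v a) ≤ᵇ toℕ (lookup v b))
  g : BoolRel M
  g a b = not (deleteAt x r a b) ∨ (toℕ (lookup u a) ≤ᵇ toℕ (lookup u b))
  diagonal : f x x ≡ true
  diagonal = trans (cong (not (r x x) ∨_) (≤ᵇ-true (≤-refl {toℕ (lookup v x)}))) (∨-zeroʳ _)
  column : ∀ a → f (punchIn x a) x ≡ true
  column a rewrite insertAt-lookup (vmap (punchIn last) u) x last | lookup-placeLast-punchIn x u a
    = trans (cong (not (r (punchIn x a) x) ∨_) (≤ᵇ-true (<⇒≤ (punchIn-fromℕ-< (lookup u a))))) (∨-zeroʳ _)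
  row : ∀ b → f x (punchIn x b) ≡ not (r x (punchIn x b))
  row b rewrite insertAt-lookup (vmap (punchIn last) u) x last | lookup-placeLast-punchIn x u b
              | ≤ᵇ-false (punchIn-fromℕ-< (lookup u b)) = ∨-identityʳ _
  rest : ∀ a b → f (punchIn x a) (punchIn x b) ≡ g a b
  rest a b rewrite lookup-placeLast-punchIn x u a | lookup-placeLast-punchIn x u b
                 | toℕ-punchIn-fromℕ (lookup u a) | toℕ-punchIn-fromℕ (lookup u b) = refl

isLinExtᵇ-placeLast : ∀ {M} (r : BoolRel (suc M)) (x : Fin (suc M)) u →
  isLinExtᵇ r (placeLast x u) ≡ isMaximal r x ∧ isLinExtᵇ (deleteAt x r) u
isLinExtᵇ-placeLast r x u = begin
  injectiveᵇ (placeLast x u) ∧ monotoneᵇ r (placeLast x u)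
    ≡⟨ cong₂ _∧_ (injectiveᵇ-placeLast x u) (monotoneᵇ-placeLast r x u) ⟩
  injectiveᵇ u ∧ (isMaximal r x ∧ monotoneᵇ (deleteAt x r) u)
    ≡⟨ ∧-Props.x∙yz≈y∙xz (injectiveᵇ u) (isMaximal r x) _ ⟩
  isMaximal r x ∧ (injectiveᵇ u ∧ monotoneᵇ (deleteAt x r) u)  ∎
  where open ≡-Reasoning

sumVecs-fixing : ∀ k m (x : Fin (suc k)) (j : Fin (suc m)) (b : Vec (Fin (suc m)) (suc k) → Bool) →
  sumVecs (suc k) (suc m) (λ v → 𝟙 (b v ∧ (lookup v x == j))) ≡ sumVecs k (suc m) (λ w → 𝟙 (b (insertAt w x j)))
sumVecs-fixing k m x j b = begin
  sumVecs (suc k) (suc m) (λ v → 𝟙 (b v ∧ (lookup v x == j)))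
    ≡⟨ sumVecs-insertAt k (suc m) x _ ⟩
  ∑[ i < suc m ] sumVecs k (suc m) (λ w → 𝟙 (b (insertAt w x i) ∧ (lookup (insertAt w x i) x == j)))
    ≡⟨ ∑ℕ.sum-cong-≗ (λ i → sumVecs-cong k (suc m) (λ w →
         cong (λ c → 𝟙 (b (insertAt w x i) ∧ (c == j))) (insertAt-lookup w x i))) ⟩
  ∑[ i < suc m ] sumVecs k (suc m) (term i)
    ≡⟨ ∑-single j (λ i → sumVecs k (suc m) (term i)) (λ i i≢j → sumVecs-zero k (suc m) (term i) (off i i≢j)) ⟩
  sumVecs k (suc m) (term j)
    ≡⟨ sumVecs-cong k (suc m) (λ w → cong 𝟙 (trans (cong (b (insertAt w x j) ∧_) (==-refl j)) (∧-identityʳ _))) ⟩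
  sumVecs k (suc m) (λ w → 𝟙 (b (insertAt w x j)))  ∎
  where
  open ≡-Reasoning
  term : Fin (suc m) → Vec (Fin (suc m)) k → ℕ
  term i w = 𝟙 (b (insertAt w x i) ∧ (i == j))
  off : ∀ i → i ≢ j → ∀ w → term i w ≡ 0
  off i i≢j w = cong 𝟙 (trans (cong (b (insertAt w x i) ∧_) (==-false i≢j)) (∧-zeroʳ _))

-- The linear extensions ranking x last are the placeLast x u with u a linear extension
-- of the relation without x; there are any only if x is maximal.
linExts-ending-at : ∀ M (r : BoolRel (suc M)) (x : Fin (suc M)) →
  sumVecs (suc M) (suc M) (λ v → 𝟙 (isLinExtᵇ r v ∧ (lookup v x == fromℕ M)))
    ≡ 𝟙 (isMaximal r x) * #linExt M (deleteAt x r)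
linExts-ending-at M r x = begin
  sumVecs (suc M) (suc M) (λ v → 𝟙 (isLinExtᵇ r v ∧ (lookup v x == last)))
    ≡⟨ sumVecs-fixing M M x last (isLinExtᵇ r) ⟩
  sumVecs M (suc M) (λ w → 𝟙 (isLinExtᵇ r (insertAt w x last)))
    ≡⟨ sumVecs-avoiding M M last _ last-repeated ⟩
  sumVecs M M (λ u → 𝟙 (isLinExtᵇ r (placeLast x u)))
    ≡⟨ sumVecs-cong M M (λ u → cong 𝟙 (isLinExtᵇ-placeLast r x u)) ⟩
  sumVecs M M (λ u → 𝟙 (isMaximal r x ∧ isLinExtᵇ (deleteAt x r) u))
    ≡⟨ factor (isMaximal r x) ⟩
  𝟙 (isMaximal r x) * #linExt M (deleteAt x r)  ∎
  where
  open ≡-Reasoning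
  last = fromℕ M
  last-repeated : ∀ w p → lookup w p ≡ last → 𝟙 (isLinExtᵇ r (insertAt w x last)) ≡ 0
  last-repeated w p wp≡last with isLinExtᵇ r (insertAt w x last) in ext
  ... | false = refl
  ... | true  = ⊥-elim (punchInᵢ≢i x p (injectiveᵇ-sound (insertAt w x last) (∧-true₁ ext) (punchIn x p) x
                  (trans (insertAt-punchIn w x last p) (trans wp≡last (sym (insertAt-lookup w x last))))))
  factor : ∀ m → sumVecs M M (λ u → 𝟙 (m ∧ isLinExtᵇ (deleteAt x r) u)) ≡ 𝟙 m * #linExt M (deleteAt x r)
  factor true  = trans (sym (#linExt-sumVecs M (deleteAt x r))) (sym (*-identityˡ _))
  factor false = sumVecs-zero M M _ (λ _ → refl)

#linExt-suc : ∀ M (r : BoolRel (suc M)) →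
  #linExt (suc M) r ≡ ∑[ x < suc M ] (𝟙 (isMaximal r x) * #linExt M (deleteAt x r))
#linExt-suc M r = begin
  #linExt (suc M) r
    ≡⟨ #linExt-sumVecs (suc M) r ⟩
  sumVecs (suc M) (suc M) (𝟙 ∘ isLinExtᵇ r)
    ≡⟨ sumVecs-cong (suc M) (suc M) split-by-last ⟩
  sumVecs (suc M) (suc M) (λ v → ∑[ x < suc M ] 𝟙 (isLinExtᵇ r v ∧ (lookup v x == fromℕ M)))
    ≡⟨ sumVecs-∑ (suc M) (suc M) (λ x v → 𝟙 (isLinExtᵇ r v ∧ (lookup v x == fromℕ M))) ⟩
  ∑[ x < suc M ] sumVecs (suc M) (suc M) (λ v → 𝟙 (isLinExtᵇ r v ∧ (lookup v x == fromℕ M)))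
    ≡⟨ ∑ℕ.sum-cong-≗ (linExts-ending-at M r) ⟩
  ∑[ x < suc M ] (𝟙 (isMaximal r x) * #linExt M (deleteAt x r))  ∎
  where
  open ≡-Reasoning
  split-by-last : ∀ v → 𝟙 (isLinExtᵇ r v) ≡ ∑[ x < suc M ] 𝟙 (isLinExtᵇ r v ∧ (lookup v x == fromℕ M))
  split-by-last v with isLinExtᵇ r v in ext
  ... | false = sym (∑ℕ.sum-replicate-zero (suc M))
  ... | true  = sym (positions-of-last v (injectiveᵇ-sound v (∧-true₁ ext)))

-- Relations with two maximal elements

isMaximal-true : ∀ {M} (r : BoolRel (suc M)) x → (∀ y → r x y ≡ true → y ≡ x) → isMaximal r x ≡ true
isMaximal-true r x maximal = ⋀-intro (λ b → not (r x (punchIn x b))) nothing-above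
  where
  nothing-above : ∀ b → not (r x (punchIn x b)) ≡ true
  nothing-above b with r x (punchIn x b) in above
  ... | false = refl
  ... | true  = ⊥-elim (punchInᵢ≢i x b (maximal _ above))

isMaximal-false : ∀ {M} (r : BoolRel (suc M)) x y → x ≢ y → r x y ≡ true → isMaximal r x ≡ false
isMaximal-false {zero}  r zero zero x≢y _ = ⊥-elim (x≢y refl)
isMaximal-false {suc M} r x    y    x≢y x≼y =
  ⋀-false (λ b → not (r x (punchIn x b))) (punchOut x≢y) (cong not (trans (cong (r x) (punchIn-punchOut x≢y)) x≼y))

record TwoMaxima {N} (r : BoolRel N) (t₀ t₁ : Fin N) : Set where
  field
    distinct  : t₀ ≢ t₁
    reflexive : ∀ a → r a a ≡ true
    below-t₀  : ∀ y → y ≢ t₁ → r y t₀ ≡ true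
    maximal₀  : ∀ y → r t₀ y ≡ true → y ≡ t₀
    maximal₁  : ∀ y → r t₁ y ≡ true → y ≡ t₁

#linExt-twoMaxima : ∀ {N} (r : BoolRel N) {t₀ t₁} → TwoMaxima r t₀ t₁ →
  #linExt N r ≡ #linExt (pred N) (deleteAt t₀ r) + #linExt (pred N) (deleteAt t₁ r)
#linExt-twoMaxima {suc zero}    r {zero} {zero} tm = ⊥-elim (TwoMaxima.distinct tm refl)
#linExt-twoMaxima {suc (suc M)} r {t₀}   {t₁}   tm = begin
  #linExt (2 + M) r
    ≡⟨ #linExt-suc (suc M) r ⟩
  ∑[ x < 2 + M ] term x
    ≡⟨ ∑-pair t₀ t₁ term distinct (λ x x≢t₀ x≢t₁ →
         cong (weight x) (isMaximal-false r x t₀ x≢t₀ (below-t₀ x x≢t₁))) ⟩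
  term t₀ + term t₁
    ≡⟨ cong₂ _+_ (kept t₀ maximal₀) (kept t₁ maximal₁) ⟩
  #linExt (suc M) (deleteAt t₀ r) + #linExt (suc M) (deleteAt t₁ r)  ∎
  where
  open ≡-Reasoning
  open TwoMaxima tm
  weight : Fin (2 + M) → Bool → ℕ
  weight x b = 𝟙 b * #linExt (suc M) (deleteAt x r)
  term : Fin (2 + M) → ℕ
  term x = weight x (isMaximal r x)
  kept : ∀ t → (∀ y → r t y ≡ true → y ≡ t) → term t ≡ #linExt (suc M) (deleteAt t r)
  kept t maximal = trans (cong (weight t) (isMaximal-true r t maximal)) (*-identityˡ _)

#linExt-greatest : ∀ {N} (r : BoolRel N) g → (∀ y → r y g ≡ true) → (∀ y → r g y ≡ true → y ≡ g) →
  #linExt N r ≡ #linExt (pred N) (deleteAt g r)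
#linExt-greatest {suc M} r g below maximal = begin
  #linExt (suc M) r
    ≡⟨ #linExt-suc M r ⟩
  ∑[ x < suc M ] term x
    ≡⟨ ∑-single g term (λ x x≢g → cong (weight x) (isMaximal-false r x g x≢g (below x))) ⟩
  term g
    ≡⟨ cong (weight g) (isMaximal-true r g maximal) ⟩
  1 * #linExt M (deleteAt g r)
    ≡⟨ *-identityˡ _ ⟩
  #linExt M (deleteAt g r)  ∎
  where
  open ≡-Reasoning
  weight : Fin (suc M) → Bool → ℕ
  weight x b = 𝟙 b * #linExt M (deleteAt x r)
  term : Fin (suc M) → ℕ
  term x = weight x (isMaximal r x)

deleteBoth : ∀ {N} (r : BoolRel N) (t₀ t₁ : Fin N) → t₀ ≢ t₁ → BoolRel (pred (pred N))
deleteBoth {suc n} r t₀ t₁ t₀≢t₁ = deleteAt (punchOut t₀≢t₁) (deleteAt t₀ r)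

punchIn-punchIn-comm : ∀ {n} (i j : Fin (suc (suc n))) (i≢j : i ≢ j) (j≢i : j ≢ i) (a : Fin n) →
  punchIn i (punchIn (punchOut i≢j) a) ≡ punchIn j (punchIn (punchOut j≢i) a)
punchIn-punchIn-comm         zero    zero    i≢j _   a       = ⊥-elim (i≢j refl)
punchIn-punchIn-comm {suc n} zero    (suc j) _   _   a       = refl
punchIn-punchIn-comm {suc n} (suc i) zero    _   _   a       = refl
punchIn-punchIn-comm {suc n} (suc i) (suc j) _   _   zero    = refl
punchIn-punchIn-comm {suc n} (suc i) (suc j) i≢j j≢i (suc a) =
  cong suc (punchIn-punchIn-comm i j (i≢j ∘ cong suc) (j≢i ∘ cong suc) a)

punchOut-≡ : ∀ {n} {i y : Fin (suc n)} (i≢y : i ≢ y) (z : Fin n) → punchIn i z ≡ y → punchOut i≢y ≡ z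
punchOut-≡ {i = i} i≢y z i↦y = punchIn-injective i _ z (trans (punchIn-punchOut i≢y) (sym i↦y))

-- Once t₁ is gone, t₀ is the greatest element.
#linExt-deleteAt-t₁ : ∀ {N} (r : BoolRel N) {t₀ t₁} (tm : TwoMaxima r t₀ t₁) →
  #linExt (pred N) (deleteAt t₁ r) ≡ #linExt (pred (pred N)) (deleteBoth r t₀ t₁ (TwoMaxima.distinct tm))
#linExt-deleteAt-t₁ {suc zero}    r {zero} {zero} tm = ⊥-elim (TwoMaxima.distinct tm refl)
#linExt-deleteAt-t₁ {suc (suc n)} r {t₀}   {t₁}   tm = begin
  #linExt (suc n) (deleteAt t₁ r)
    ≡⟨ #linExt-greatest (deleteAt t₁ r) g below maximal ⟩
  #linExt n (deleteAt g (deleteAt t₁ r))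
    ≡⟨ #linExt-cong n (λ a b → cong₂ r (commute a) (commute b)) ⟩
  #linExt n (deleteBoth r t₀ t₁ distinct)  ∎
  where
  open ≡-Reasoning
  open TwoMaxima tm
  g = punchOut (distinct ∘ sym)
  punchIn-g : punchIn t₁ g ≡ t₀
  punchIn-g = punchIn-punchOut (distinct ∘ sym)
  below : ∀ y → deleteAt t₁ r y g ≡ true
  below y = trans (cong (r (punchIn t₁ y)) punchIn-g) (below-t₀ (punchIn t₁ y) (punchInᵢ≢i t₁ y))
  maximal : ∀ y → deleteAt t₁ r g y ≡ true → y ≡ g
  maximal y g≼y = punchIn-injective t₁ y g
    (trans (maximal₀ (punchIn t₁ y) (subst (λ z → r z (punchIn t₁ y) ≡ true) punchIn-g g≼y)) (sym punchIn-g))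
  commute : ∀ a → punchIn t₁ (punchIn g a) ≡ punchIn t₀ (punchIn (punchOut distinct) a)
  commute = punchIn-punchIn-comm t₁ t₀ (distinct ∘ sym) distinct

-- Relabelling along an equality of sizes

record _≅_ {N N′} (r : BoolRel N) (r′ : BoolRel N′) : Set where
  field
    size≡ : N ≡ N′
    rel≡  : ∀ a b → r′ (cast size≡ a) (cast size≡ b) ≡ r a b

≅-pointwise : ∀ {N} {r r′ : BoolRel N} → (∀ a b → r′ a b ≡ r a b) → r ≅ r′
≅-pointwise {r′ = r′} r′≗r = record
  { size≡ = refl
  ; rel≡  = λ a b → trans (cong₂ r′ (cast-is-id refl a) (cast-is-id refl b)) (r′≗r a b) }

≅-cast : ∀ {N N′} (r : BoolRel N) (e : N ≡ N′) → r ≅ (λ a b → r (cast (sym e) a) (cast (sym e) b))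
≅-cast r refl = ≅-pointwise (λ a b → cong₂ r (cast-is-id refl a) (cast-is-id refl b))

≅⇒pointwise : ∀ {N} {r r′ : BoolRel N} → r ≅ r′ → ∀ a b → r a b ≡ r′ a b
≅⇒pointwise {r′ = r′} record { size≡ = refl ; rel≡ = rel≡ } a b =
  trans (sym (rel≡ a b)) (cong₂ r′ (cast-is-id refl a) (cast-is-id refl b))

#linExt-≅ : ∀ {N N′} {r : BoolRel N} {r′ : BoolRel N′} → r ≅ r′ → #linExt N r ≡ #linExt N′ r′
#linExt-≅ {N} iso@record { size≡ = refl } = #linExt-cong N (≅⇒pointwise iso)

≅-deleteAt : ∀ {N N′} {r : BoolRel N} {r′ : BoolRel N′} (iso : r ≅ r′) (x : Fin N) (x′ : Fin N′) →
  cast (_≅_.size≡ iso) x ≡ x′ → deleteAt x r ≅ deleteAt x′ r′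
≅-deleteAt {suc M} {r′ = r′} iso@record { size≡ = refl } x x′ x↦x′ = ≅-pointwise λ a b →
  trans (cong (λ z → r′ (punchIn z a) (punchIn z b)) (trans (sym x↦x′) (cast-is-id refl x)))
        (sym (≅⇒pointwise iso (punchIn x a) (punchIn x b)))

≅-deleteBoth : ∀ {N N′} {r : BoolRel N} {r′ : BoolRel N′} (iso : r ≅ r′) {t₀ t₁ : Fin N} {t₀′ t₁′ : Fin N′}
  (t₀≢t₁ : t₀ ≢ t₁) (t₀′≢t₁′ : t₀′ ≢ t₁′) →
  cast (_≅_.size≡ iso) t₀ ≡ t₀′ → cast (_≅_.size≡ iso) t₁ ≡ t₁′ →
  deleteBoth r t₀ t₁ t₀≢t₁ ≅ deleteBoth r′ t₀′ t₁′ t₀′≢t₁′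
≅-deleteBoth {suc zero} record { size≡ = refl } {zero} {zero} t₀≢t₁ _ _ _ = ⊥-elim (t₀≢t₁ refl)
≅-deleteBoth {suc (suc m)} {r = r} {r′} iso@record { size≡ = refl } {t₀} {t₁}
             t₀≢t₁ t₀′≢t₁′ t₀↦t₀′ t₁↦t₁′
  with trans (sym (cast-is-id refl t₀)) t₀↦t₀′ | trans (sym (cast-is-id refl t₁)) t₁↦t₁′
... | refl | refl = ≅-pointwise λ a b →
  trans (cong (λ p → r′ (punchIn t₀ (punchIn p a)) (punchIn t₀ (punchIn p b))) (punchOut-cong t₀ refl))
        (sym (≅⇒pointwise iso _ _))

-- The posets Q(m) and their splices

TwoTopped : SPoset → Set
TwoTopped P = TwoMaxima (rel P) (top₀ P) (top₁ P)

relQ-refl : ∀ k i → relQ k i i ≡ true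
relQ-refl k i rewrite ==-refl i = refl

relQ-true : ∀ k i j → 2 + toℕ i ≤ toℕ j → relQ k i j ≡ true
relQ-true k i j i+2≤j rewrite ≤ᵇ-true i+2≤j = ∨-zeroʳ _

relQ-maximal : ∀ k i j → relQ k i j ≡ true → toℕ j < 2 + toℕ i → i ≡ j
relQ-maximal k i j i≼j j<i+2 with i ≟ j
... | yes i≡j = i≡j
... | no i≢j rewrite ≤ᵇ-false {2 + toℕ i} {toℕ j} j<i+2 with i≼j
...   | ()

relQ-maximal-suc² : ∀ k (t j : Fin k) → relQ k (suc (suc t)) (suc (suc j)) ≡ true → toℕ j < 2 + toℕ t → j ≡ t
relQ-maximal-suc² k t j t≼j j<t+2 = sym (Fin.suc-injective (Fin.suc-injective (relQ-maximal k _ _ t≼j (s≤s (s≤s j<t+2)))))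

relQ-toℕ : ∀ k k′ i j i′ j′ → toℕ i ≡ toℕ i′ → toℕ j ≡ toℕ j′ → relQ k i j ≡ relQ k′ i′ j′
relQ-toℕ k k′ i j i′ j′ i≈i′ j≈j′ rewrite ==-toℕ i j i′ j′ i≈i′ j≈j′ | i≈i′ | j≈j′ = refl

lastQ≡suc-fromℕ : ∀ k → lastQ k ≡ suc (fromℕ k)
lastQ≡suc-fromℕ zero    = refl
lastQ≡suc-fromℕ (suc k) = cong suc (lastQ≡suc-fromℕ k)

toℕ-penQ : ∀ k → toℕ (penQ k) ≡ k
toℕ-penQ zero    = refl
toℕ-penQ (suc k) = cong suc (toℕ-penQ k)

toℕ-lastQ : ∀ k → toℕ (lastQ k) ≡ suc k
toℕ-lastQ zero    = refl
toℕ-lastQ (suc k) = cong suc (toℕ-lastQ k)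

twoTopped-Q′ : ∀ k → TwoTopped (Q′ (suc k))
twoTopped-Q′ k = record
  { distinct = distinct ; reflexive = relQ-refl (suc k) ; below-t₀ = below-t₀ ; maximal₀ = maximal₀ ; maximal₁ = maximal₁ }
  where
  t₀ = lastQ (suc k)
  t₁ = penQ (suc k)
  toℕ-t₀ : toℕ t₀ ≡ 2 + k
  toℕ-t₀ = toℕ-lastQ (suc k)
  toℕ-t₁ : toℕ t₁ ≡ 1 + k
  toℕ-t₁ = toℕ-penQ (suc k)
  distinct : t₀ ≢ t₁
  distinct t₀≡t₁ = <-irrefl (trans (sym toℕ-t₁) (trans (cong toℕ (sym t₀≡t₁)) toℕ-t₀)) ≤-refl
  below-t₀ : ∀ y → y ≢ t₁ → relQ (suc k) y t₀ ≡ true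
  below-t₀ y y≢t₁ with toℕ y ≟ℕ toℕ t₀
  ... | yes y≈t₀ = subst (λ z → relQ (suc k) z t₀ ≡ true) (toℕ-injective (sym y≈t₀)) (relQ-refl (suc k) t₀)
  ... | no y≉t₀  = relQ-true (suc k) y t₀ (subst (2 + toℕ y ≤_) (sym toℕ-t₀) (s≤s (s≤s y≤k)))
    where
    y≤1+k : toℕ y ≤ suc k
    y≤1+k = ≤-pred (≤∧≢⇒< (≤-pred (toℕ<n y)) (λ y≈ → y≉t₀ (trans y≈ (sym toℕ-t₀))))
    y≤k : toℕ y ≤ k
    y≤k = ≤-pred (≤∧≢⇒< y≤1+k (λ y≈ → y≢t₁ (toℕ-injective (trans y≈ (sym toℕ-t₁)))))
  maximal₀ : ∀ y → relQ (suc k) t₀ y ≡ true → y ≡ t₀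
  maximal₀ y t₀≼y = sym (relQ-maximal (suc k) t₀ y t₀≼y
    (subst (λ z → toℕ y < 2 + z) (sym toℕ-t₀) (≤-trans (toℕ<n y) (m≤n⇒m≤1+n ≤-refl))))
  maximal₁ : ∀ y → relQ (suc k) t₁ y ≡ true → y ≡ t₁
  maximal₁ y t₁≼y = sym (relQ-maximal (suc k) t₁ y t₁≼y (subst (λ z → toℕ y < 2 + z) (sym toℕ-t₁) (toℕ<n y)))

data SumView (N m : ℕ) : Fin (N + m) → Set where
  inl : (a : Fin N) → SumView N m (a ↑ˡ m)
  inr : (j : Fin m) → SumView N m (N ↑ʳ j)

sumView : ∀ N m x → SumView N m x
sumView N m x = subst (SumView N m) (join-splitAt N m x) (fromSplit (splitAt N x))
  where
  fromSplit : (s : Fin N ⊎ Fin m) → SumView N m (join N m s)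
  fromSplit (inj₁ a) = inl a
  fromSplit (inj₂ j) = inr j

↑ˡ≢↑ʳ : ∀ {N m} (a : Fin N) (j : Fin m) → a ↑ˡ m ≢ N ↑ʳ j
↑ˡ≢↑ʳ {N} {m} a j eq with trans (sym (splitAt-↑ˡ N a m)) (trans (cong (splitAt N) eq) (splitAt-↑ʳ N m j))
... | ()

∨-absorbed : ∀ x y → (y ≡ true → x ≡ true) → (x ∨ y) ≡ x
∨-absorbed true  y     _   = refl
∨-absorbed false false _   = refl
∨-absorbed false true  y⇒x = sym (y⇒x refl)

via-p₀ : ∀ {x y} → ((x ∧ true) ∨ (y ∧ false)) ≡ true → x ≡ true
via-p₀ {true} _ = refl
via-p₀ {false} {true}  ()
via-p₀ {false} {false} ()

via-p₁ : ∀ {x y} → ((x ∧ false) ∨ (y ∧ true)) ≡ true → y ≡ true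
via-p₁ {true}  {true}  _ = refl
via-p₁ {false} {true}  _ = refl
via-p₁ {true}  {false} ()
via-p₁ {false} {false} ()

∨-false-right : ∀ {x y} → (x ∨ (y ∧ false)) ≡ true → x ≡ true
∨-false-right {true} _ = refl
∨-false-right {false} {true}  ()
∨-false-right {false} {false} ()

module _ (P : SPoset) where
  private
    N  = size P
    R  = rel P
    p₀ = top₀ P
    p₁ = top₁ P

  splice-↑ˡ-↑ˡ : (∀ a → R a a ≡ true) → p₀ ≢ p₁ → ∀ k a b → rel (spliceQ P k) (a ↑ˡ k) (b ↑ˡ k) ≡ R a b
  splice-↑ˡ-↑ˡ refl-R p₀≢p₁ k a b rewrite splitAt-↑ˡ N a k | splitAt-↑ˡ N b k
    with a ≟ p₀ | a ≟ p₁ | b ≟ p₀ | b ≟ p₁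
  ... | yes refl | yes a≡p₁ | _        | _        = ⊥-elim (p₀≢p₁ a≡p₁)
  ... | _        | _        | yes refl | yes b≡p₁ = ⊥-elim (p₀≢p₁ b≡p₁)
  ... | yes refl | no _     | yes refl | no _     = ∨-absorbed _ _ (λ _ → refl-R _)
  ... | yes refl | no _     | no _     | yes refl = ∨-absorbed _ _ via-p₁
  ... | yes refl | no _     | no _     | no _     = ∨-absorbed _ _ (λ ())
  ... | no _     | yes refl | yes refl | no _     = ∨-absorbed _ _ via-p₀
  ... | no _     | yes refl | no _     | yes refl = ∨-absorbed _ _ (λ _ → refl-R _)
  ... | no _     | yes refl | no _     | no _     = ∨-absorbed _ _ (λ ())
  ... | no _     | no _     | yes refl | no _     = ∨-absorbed _ _ via-p₀
  ... | no _     | no _     | no _     | yes refl = ∨-absorbed _ _ via-p₁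
  ... | no _     | no _     | no _     | no _     = ∨-absorbed _ _ (λ ())

  splice-↑ˡ-↑ʳ : (∀ a → R a a ≡ true) → p₀ ≢ p₁ → ∀ k a (j : Fin k) →
    rel (spliceQ P k) (a ↑ˡ k) (N ↑ʳ j) ≡ (R a p₀ ∨ (R a p₁ ∧ (3 ≤ᵇ 2 + toℕ j)))
  splice-↑ˡ-↑ʳ refl-R p₀≢p₁ k a j rewrite splitAt-↑ˡ N a k | splitAt-↑ʳ N k j with a ≟ p₀ | a ≟ p₁
  ... | yes refl | yes a≡p₁ = ⊥-elim (p₀≢p₁ a≡p₁)
  ... | yes refl | no _ rewrite refl-R p₀ = refl
  ... | no _     | yes refl rewrite refl-R p₁ = absorb (R p₁ p₀) (3 ≤ᵇ 2 + toℕ j)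
    where
    absorb : ∀ x c → (c ∨ ((x ∧ true) ∨ c)) ≡ (x ∨ c)
    absorb true  true  = refl
    absorb true  false = refl
    absorb false true  = refl
    absorb false false = refl
  ... | no _     | no _ rewrite ∧-identityʳ (R a p₀) = refl

  splice-↑ʳ-↑ˡ : ∀ k (j : Fin k) b → rel (spliceQ P k) (N ↑ʳ j) (b ↑ˡ k) ≡ false
  splice-↑ʳ-↑ˡ k j b rewrite splitAt-↑ʳ N k j | splitAt-↑ˡ N b k with b ≟ p₀ | b ≟ p₁
  ... | yes _ | _     = refl
  ... | no _  | yes _ = refl
  ... | no _  | no _  = refl

  splice-↑ʳ-↑ʳ : ∀ k (j j′ : Fin k) → rel (spliceQ P k) (N ↑ʳ j) (N ↑ʳ j′) ≡ relQ k (suc (suc j)) (suc (suc j′))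
  splice-↑ʳ-↑ʳ k j j′ rewrite splitAt-↑ʳ N k j | splitAt-↑ʳ N k j′ = ∨-identityʳ _

  spliceQ-maximal-inr : ∀ k (t : Fin k) → (∀ j → relQ k (suc (suc t)) (suc (suc j)) ≡ true → j ≡ t) →
    ∀ y → rel (spliceQ P k) (N ↑ʳ t) y ≡ true → y ≡ N ↑ʳ t
  spliceQ-maximal-inr k t maximal y t≼y with sumView N k y
  ... | inl c with trans (sym (splice-↑ʳ-↑ˡ k t c)) t≼y
  ...   | ()
  spliceQ-maximal-inr k t maximal y t≼y | inr j = cong (N ↑ʳ_) (maximal j (trans (sym (splice-↑ʳ-↑ʳ k t j)) t≼y))

  spliceQ-top₀-maximal : ∀ k y → rel (spliceQ P (suc k)) (N ↑ʳ fromℕ k) y ≡ true → y ≡ N ↑ʳ fromℕ k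
  spliceQ-top₀-maximal k = spliceQ-maximal-inr (suc k) (fromℕ k) λ j t≼j →
    relQ-maximal-suc² (suc k) (fromℕ k) j t≼j
      (subst (λ z → toℕ j < 2 + z) (sym (toℕ-fromℕ k)) (≤-trans (toℕ<n j) (m≤n⇒m≤1+n ≤-refl)))

top₀-spliceQ : ∀ P k → top₀ (spliceQ P (suc k)) ≡ size P ↑ʳ fromℕ k
top₀-spliceQ P k rewrite lastQ≡suc-fromℕ k = refl

module _ (P : SPoset) (two : TwoTopped P) where
  open TwoMaxima two
  private
    N  = size P
    R  = rel P
    p₀ = top₀ P
    p₁ = top₁ P

  spliceQ-reflexive : ∀ k a → rel (spliceQ P k) a a ≡ true
  spliceQ-reflexive k a with sumView N k a
  ... | inl c = trans (splice-↑ˡ-↑ˡ P reflexive distinct k c c) (reflexive c)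
  ... | inr j = trans (splice-↑ʳ-↑ʳ P k j j) (relQ-refl k (suc (suc j)))

  twoTopped-spliceQ₁ : TwoMaxima (rel (spliceQ P 1)) (N ↑ʳ zero) (p₁ ↑ˡ 1)
  twoTopped-spliceQ₁ = record
    { distinct  = λ eq → ↑ˡ≢↑ʳ p₁ zero (sym eq)
    ; reflexive = spliceQ-reflexive 1
    ; below-t₀  = below
    ; maximal₀  = spliceQ-top₀-maximal P 0
    ; maximal₁  = maximal-p₁ }
    where
    below : ∀ y → y ≢ p₁ ↑ˡ 1 → rel (spliceQ P 1) y (N ↑ʳ zero) ≡ true
    below y y≢p₁ with sumView N 1 y
    ... | inr zero = spliceQ-reflexive 1 (N ↑ʳ zero)
    ... | inl c with c ≟ p₁
    ...   | yes refl = ⊥-elim (y≢p₁ refl)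
    ...   | no c≢p₁ rewrite splice-↑ˡ-↑ʳ P reflexive distinct 1 c zero | below-t₀ c c≢p₁ = refl
    maximal-p₁ : ∀ y → rel (spliceQ P 1) (p₁ ↑ˡ 1) y ≡ true → y ≡ p₁ ↑ˡ 1
    maximal-p₁ y p₁≼y with sumView N 1 y
    ... | inl c    = cong (_↑ˡ 1) (maximal₁ c (trans (sym (splice-↑ˡ-↑ˡ P reflexive distinct 1 p₁ c)) p₁≼y))
    ... | inr zero = ⊥-elim (distinct (maximal₁ p₀
                       (∨-false-right (trans (sym (splice-↑ˡ-↑ʳ P reflexive distinct 1 p₁ zero)) p₁≼y))))

  twoTopped-spliceQ₂₊ : ∀ k → TwoMaxima (rel (spliceQ P (2 + k))) (N ↑ʳ fromℕ (suc k)) (N ↑ʳ penQ k)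
  twoTopped-spliceQ₂₊ k = record
    { distinct  = distinct′
    ; reflexive = spliceQ-reflexive (2 + k)
    ; below-t₀  = below
    ; maximal₀  = spliceQ-top₀-maximal P (suc k)
    ; maximal₁  = spliceQ-maximal-inr P (2 + k) (penQ k) λ j t≼j →
        relQ-maximal-suc² (2 + k) (penQ k) j t≼j (subst (λ z → toℕ j < 2 + z) (sym (toℕ-penQ k)) (toℕ<n j)) }
    where
    toℕ-t₀ = toℕ-fromℕ (suc k)
    distinct′ : N ↑ʳ fromℕ (suc k) ≢ N ↑ʳ penQ k
    distinct′ eq = <-irrefl (trans (sym (toℕ-penQ k)) (trans (sym (cong toℕ (↑ʳ-injective N _ _ eq))) toℕ-t₀)) ≤-refl
    below : ∀ y → y ≢ N ↑ʳ penQ k → rel (spliceQ P (2 + k)) y (N ↑ʳ fromℕ (suc k)) ≡ true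
    below y y≢t₁ with sumView N (2 + k) y
    ... | inl c with c ≟ p₁
    ...   | yes refl rewrite splice-↑ˡ-↑ʳ P reflexive distinct (2 + k) p₁ (fromℕ (suc k)) | reflexive p₁ = ∨-zeroʳ _
    ...   | no c≢p₁  rewrite splice-↑ˡ-↑ʳ P reflexive distinct (2 + k) c (fromℕ (suc k)) | below-t₀ c c≢p₁ = refl
    below y y≢t₁ | inr j with toℕ j ≟ℕ suc k
    ...   | yes j≈t₀ = trans (splice-↑ʳ-↑ʳ P (2 + k) j (fromℕ (suc k)))
                         (subst (λ z → relQ (2 + k) (suc (suc z)) (suc (suc (fromℕ (suc k)))) ≡ true)
                                (sym (toℕ-injective (trans j≈t₀ (sym toℕ-t₀))))
                                (relQ-refl (2 + k) (suc (suc (fromℕ (suc k))))))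
    ...   | no j≉t₀  = trans (splice-↑ʳ-↑ʳ P (2 + k) j (fromℕ (suc k))) (relQ-true _ _ _ j+2≤t₀)
      where
      j≤k : toℕ j ≤ k
      j≤k = ≤-pred (≤∧≢⇒< (≤-pred (toℕ<n j)) j≉t₀)
      j<k : toℕ j < k
      j<k = ≤∧≢⇒< j≤k (λ j≈ → y≢t₁ (cong (N ↑ʳ_) (toℕ-injective (trans j≈ (sym (toℕ-penQ k))))))
      j+2≤t₀ : 2 + toℕ (suc (suc j)) ≤ toℕ (suc (suc (fromℕ (suc k))))
      j+2≤t₀ rewrite toℕ-fromℕ k = s≤s (s≤s (s≤s j<k))

  twoTopped-spliceQ : ∀ k → TwoTopped (spliceQ P (suc k))
  twoTopped-spliceQ zero    = twoTopped-spliceQ₁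
  twoTopped-spliceQ (suc k) = subst (λ t → TwoMaxima (rel (spliceQ P (2 + k))) (N ↑ʳ t) (N ↑ʳ penQ k))
                                    (sym (lastQ≡suc-fromℕ k)) (twoTopped-spliceQ₂₊ k)

-- Deleting the maximal elements of a splice

l∖p₀ : SPoset → ℕ
l∖p₀ P = #linExt (pred (size P)) (deleteAt (top₀ P) (rel P))

l∖p₁ : SPoset → ℕ
l∖p₁ P = #linExt (pred (size P)) (deleteAt (top₁ P) (rel P))

l≡l∖p₀+l∖p₁ : ∀ P → TwoTopped P → l P ≡ l∖p₀ P + l∖p₁ P
l≡l∖p₀+l∖p₁ P = #linExt-twoMaxima (rel P)

module _ (P : SPoset) (two : TwoTopped P) where
  open TwoMaxima two
  private
    N  = size P
    R  = rel P
    p₀ = top₀ P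
    p₁ = top₁ P

  module _ (k : ℕ) where
    private
      size≡ : N + suc k ≡ suc (N + k)
      size≡ = +-suc N k
      r = rel (spliceQ P (suc k))
      r″ : BoolRel (suc (N + k))
      r″ a b = r (cast (sym size≡) a) (cast (sym size≡) b)
      last = fromℕ (N + k)

      top₀↦last : cast size≡ (top₀ (spliceQ P (suc k))) ≡ last
      top₀↦last = toℕ-injective (begin
        toℕ (cast size≡ (top₀ (spliceQ P (suc k))))  ≡⟨ toℕ-cast size≡ _ ⟩
        toℕ (top₀ (spliceQ P (suc k)))               ≡⟨ cong toℕ (top₀-spliceQ P k) ⟩
        toℕ (N ↑ʳ fromℕ k)                           ≡⟨ toℕ-↑ʳ N (fromℕ k) ⟩
        N + toℕ (fromℕ k)                            ≡⟨ cong (N +_) (toℕ-fromℕ k) ⟩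
        N + k                                        ≡⟨ toℕ-fromℕ (N + k) ⟨
        toℕ last                                     ∎)
        where open ≡-Reasoning

      inl↦ : ∀ c → cast (sym size≡) (punchIn last (c ↑ˡ k)) ≡ c ↑ˡ suc k
      inl↦ c = toℕ-injective (trans (toℕ-cast (sym size≡) _)
        (trans (toℕ-punchIn-fromℕ (c ↑ˡ k)) (trans (toℕ-↑ˡ c k) (sym (toℕ-↑ˡ c (suc k))))))

      inr↦ : ∀ j → cast (sym size≡) (punchIn last (N ↑ʳ j)) ≡ N ↑ʳ inject₁ j
      inr↦ j = toℕ-injective (trans (toℕ-cast (sym size≡) _) (trans (toℕ-punchIn-fromℕ (N ↑ʳ j))
        (trans (toℕ-↑ʳ N j) (trans (cong (N +_) (sym (toℕ-inject₁ j))) (sym (toℕ-↑ʳ N (inject₁ j)))))))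

      without-top : ∀ a b → deleteAt last r″ a b ≡ rel (spliceQ P k) a b
      without-top a b with sumView N k a | sumView N k b
      ... | inl c | inl d rewrite inl↦ c | inl↦ d =
        trans (splice-↑ˡ-↑ˡ P reflexive distinct (suc k) c d) (sym (splice-↑ˡ-↑ˡ P reflexive distinct k c d))
      ... | inl c | inr j rewrite inl↦ c | inr↦ j | splice-↑ˡ-↑ʳ P reflexive distinct (suc k) c (inject₁ j)
                                | splice-↑ˡ-↑ʳ P reflexive distinct k c j | toℕ-inject₁ j = refl
      ... | inr j | inl d rewrite inr↦ j | inl↦ d | splice-↑ʳ-↑ˡ P (suc k) (inject₁ j) d
                                | splice-↑ʳ-↑ˡ P k j d = refl
      ... | inr j | inr j′ rewrite inr↦ j | inr↦ j′ | splice-↑ʳ-↑ʳ P (suc k) (inject₁ j) (inject₁ j′)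
                                 | splice-↑ʳ-↑ʳ P k j j′ =
        relQ-toℕ _ _ _ _ _ _ (cong (2 +_) (toℕ-inject₁ j)) (cong (2 +_) (toℕ-inject₁ j′))

      deleteAt-top≅ : deleteAt (top₀ (spliceQ P (suc k))) r ≅ deleteAt last r″
      deleteAt-top≅ = ≅-deleteAt (≅-cast r size≡) (top₀ (spliceQ P (suc k))) last top₀↦last

    l∖p₀-spliceQ-suc : l∖p₀ (spliceQ P (suc k)) ≡ l (spliceQ P k)
    l∖p₀-spliceQ-suc = trans (#linExt-≅ deleteAt-top≅) (#linExt-cong (N + k) without-top)

    -- In P □ Q(k+3) the element p₁ sits where p₀ sits in P □ Q(k+2).
    l∖p₁-spliceQ-suc : l∖p₁ (spliceQ P (suc k)) ≡ l∖p₀ (spliceQ P k)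
    l∖p₁-spliceQ-suc = begin
      l∖p₁ (spliceQ P (suc k))
        ≡⟨ #linExt-deleteAt-t₁ r two′ ⟩
      #linExt _ (deleteBoth r t₀ t₁ (TwoMaxima.distinct two′))
        ≡⟨ #linExt-≅ (≅-deleteBoth (≅-cast r size≡) (TwoMaxima.distinct two′) last≢t₁′ top₀↦last refl) ⟩
      #linExt (pred (N + k)) (deleteAt (punchOut last≢t₁′) (deleteAt last r″))
        ≡⟨ #linExt-≅ (≅-deleteAt (≅-pointwise (λ a b → sym (without-top a b)))
                        (punchOut last≢t₁′) (top₀ (spliceQ P k))
                        (trans (cast-is-id refl _) (punchOut-≡ last≢t₁′ _ top₀↦t₁))) ⟩
      l∖p₀ (spliceQ P k)  ∎
      where
      open ≡-Reasoning
      two′ = twoTopped-spliceQ P two k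
      t₀ = top₀ (spliceQ P (suc k))
      t₁ = top₁ (spliceQ P (suc k))
      t₁′ = cast size≡ t₁
      last≢t₁′ : last ≢ t₁′
      last≢t₁′ eq = TwoMaxima.distinct two′ (toℕ-injective
        (trans (sym (toℕ-cast size≡ _)) (trans (cong toℕ (trans top₀↦last eq)) (toℕ-cast size≡ _))))
      toℕ-top₀≡toℕ-top₁ : ∀ k → toℕ (top₀ (spliceQ P k)) ≡ toℕ (top₁ (spliceQ P (suc k)))
      toℕ-top₀≡toℕ-top₁ zero    = trans (toℕ-↑ˡ p₁ 0) (sym (toℕ-↑ˡ p₁ 1))
      toℕ-top₀≡toℕ-top₁ (suc k) = trans (cong toℕ (top₀-spliceQ P k)) (trans (toℕ-↑ʳ N (fromℕ k))
        (trans (cong (N +_) (trans (toℕ-fromℕ k) (sym (toℕ-penQ k)))) (sym (toℕ-↑ʳ N (penQ k)))))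
      top₀↦t₁ : punchIn last (top₀ (spliceQ P k)) ≡ t₁′
      top₀↦t₁ = toℕ-injective
        (trans (toℕ-punchIn-fromℕ _) (trans (toℕ-top₀≡toℕ-top₁ k) (sym (toℕ-cast size≡ t₁))))

  private
    spliceQ₀≅P : rel (spliceQ P 0) ≅ R
    spliceQ₀≅P = record { size≡ = +-identityʳ N ; rel≡ = agree }
      where
      inl↦ : ∀ c → cast (+-identityʳ N) (c ↑ˡ 0) ≡ c
      inl↦ c = toℕ-injective (trans (toℕ-cast (+-identityʳ N) _) (toℕ-↑ˡ c 0))
      agree : ∀ a b → R (cast (+-identityʳ N) a) (cast (+-identityʳ N) b) ≡ rel (spliceQ P 0) a b
      agree a b with sumView N 0 a | sumView N 0 b
      ... | inl c  | inl d = trans (cong₂ R (inl↦ c) (inl↦ d)) (sym (splice-↑ˡ-↑ˡ P reflexive distinct 0 c d))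
      ... | inr () | _
      ... | _      | inr ()

  -- Q(2) has no element of its own: P □ Q(2) is P, but with the roles of p₀ and p₁ exchanged.
  l-spliceQ-zero : l (spliceQ P 0) ≡ l P
  l-spliceQ-zero = #linExt-≅ spliceQ₀≅P

  l∖p₀-spliceQ-zero : l∖p₀ (spliceQ P 0) ≡ l∖p₁ P
  l∖p₀-spliceQ-zero = #linExt-≅ (≅-deleteAt spliceQ₀≅P (p₁ ↑ˡ 0) p₁
    (toℕ-injective (trans (toℕ-cast (+-identityʳ N) _) (toℕ-↑ˡ p₁ 0))))

l∖p₀-Q′-suc : ∀ k → l∖p₀ (Q′ (suc k)) ≡ l (Q′ k)
l∖p₀-Q′-suc k = trans (cong (λ t → #linExt (2 + k) (deleteAt t (relQ (suc k)))) (cong suc (lastQ≡suc-fromℕ k)))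
  (#linExt-cong (2 + k) λ a b → relQ-toℕ (suc k) k _ _ a b (toℕ-punchIn-fromℕ a) (toℕ-punchIn-fromℕ b))

l∖p₁-Q′-suc : ∀ k → l∖p₁ (Q′ (suc k)) ≡ l∖p₀ (Q′ k)
l∖p₁-Q′-suc k = begin
  l∖p₁ (Q′ (suc k))
    ≡⟨ #linExt-deleteAt-t₁ (relQ (suc k)) two ⟩
  #linExt _ (deleteBoth (relQ (suc k)) t₀ t₁ (TwoMaxima.distinct two))
    ≡⟨ #linExt-≅ (≅-deleteBoth (≅-pointwise {r = relQ (suc k)} (λ _ _ → refl))
                    (TwoMaxima.distinct two) last≢t₁ t₀↦last (cast-is-id refl t₁)) ⟩
  #linExt (1 + k) (deleteAt (punchOut last≢t₁) (deleteAt last (relQ (suc k))))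
    ≡⟨ #linExt-≅ (≅-deleteAt (≅-pointwise (λ a b →
                      relQ-toℕ k (suc k) a b _ _ (sym (toℕ-punchIn-fromℕ a)) (sym (toℕ-punchIn-fromℕ b))))
                    (punchOut last≢t₁) (lastQ k) (trans (cast-is-id refl _) (punchOut-≡ last≢t₁ _ lastQ↦t₁))) ⟩
  l∖p₀ (Q′ k)  ∎
  where
  open ≡-Reasoning
  two = twoTopped-Q′ k
  t₀ = lastQ (suc k)
  t₁ = penQ (suc k)
  last = fromℕ (2 + k)
  t₀↦last : cast refl t₀ ≡ last
  t₀↦last = trans (cast-is-id refl t₀) (cong suc (lastQ≡suc-fromℕ k))
  last≢t₁ : last ≢ t₁
  last≢t₁ eq = TwoMaxima.distinct two (trans (cong suc (lastQ≡suc-fromℕ k)) eq)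
  lastQ↦t₁ : punchIn last (lastQ k) ≡ t₁
  lastQ↦t₁ = toℕ-injective (trans (toℕ-punchIn-fromℕ (lastQ k)) (trans (toℕ-lastQ k) (sym (toℕ-penQ (suc k)))))

-- Lists of factors

-- F k behaves like R □ Q(k + 2) for some fixed R.
record QTower (F : ℕ → SPoset) : Set where
  field
    twoTopped : ∀ k → TwoTopped (F (suc k))
    l∖p₀-suc  : ∀ k → l∖p₀ (F (suc k)) ≡ l (F k)
    l∖p₁-suc  : ∀ k → l∖p₁ (F (suc k)) ≡ l∖p₀ (F k)

  l-suc : ∀ k → l (F (suc k)) ≡ l (F k) + l∖p₁ (F (suc k))
  l-suc k = trans (l≡l∖p₀+l∖p₁ (F (suc k)) (twoTopped k)) (cong (_+ l∖p₁ (F (suc k))) (l∖p₀-suc k))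

  l∖p₁-suc² : ∀ k → l∖p₁ (F (2 + k)) ≡ l (F k)
  l∖p₁-suc² k = trans (l∖p₁-suc (suc k)) (l∖p₀-suc k)

QTower-cong : ∀ {F G} → (∀ k → F k ≡ G k) → QTower F → QTower G
QTower-cong {F} {G} F≗G tower = record
  { twoTopped = λ k → subst TwoTopped (F≗G (suc k)) (twoTopped k)
  ; l∖p₀-suc  = λ k → subst₂ (λ P P′ → l∖p₀ P ≡ l P′) (F≗G (suc k)) (F≗G k) (l∖p₀-suc k)
  ; l∖p₁-suc  = λ k → subst₂ (λ P P′ → l∖p₁ P ≡ l∖p₀ P′) (F≗G (suc k)) (F≗G k) (l∖p₁-suc k) }
  where open QTower tower

Q′-tower : QTower Q′
Q′-tower = record { twoTopped = twoTopped-Q′ ; l∖p₀-suc = l∖p₀-Q′-suc ; l∖p₁-suc = l∖p₁-Q′-suc }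

spliceQ-tower : ∀ P → TwoTopped P → QTower (spliceQ P)
spliceQ-tower P two = record
  { twoTopped = twoTopped-spliceQ P two ; l∖p₀-suc = l∖p₀-spliceQ-suc P two ; l∖p₁-suc = l∖p₁-spliceQ-suc P two }

spliceQ₁-l∖p₁ : ∀ P → TwoTopped P → l∖p₁ (spliceQ P 1) ≡ l∖p₁ P
spliceQ₁-l∖p₁ P two = trans (l∖p₁-spliceQ-suc P two 0) (l∖p₀-spliceQ-zero P two)

spliceQ₁-l : ∀ P → TwoTopped P → l (spliceQ P 1) ≡ l P + l∖p₁ P
spliceQ₁-l P two = trans (QTower.l-suc (spliceQ-tower P two) 0)
                         (cong₂ _+_ (l-spliceQ-zero P two) (spliceQ₁-l∖p₁ P two))

spliceStep : SPoset → ℕ → SPoset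
spliceStep P m = spliceQ P (m ∸ 2)

splice-++ : ∀ W ms → W ≢ [] → splice (W ++ ms) ≡ foldl spliceStep (splice W) ms
splice-++ []       ms W≢[] = ⊥-elim (W≢[] refl)
splice-++ (n ∷ ns) ms _    = foldl-++ spliceStep (Q n) ns ms

twoTopped-foldl : ∀ P ms → TwoTopped P → All (3 ≤_) ms → TwoTopped (foldl spliceStep P ms)
twoTopped-foldl P []                        two []                             = two
twoTopped-foldl P (.(3 + k) ∷ ms) two (s≤s (s≤s (s≤s {n = k} _)) ∷ 3≤ms) =
  twoTopped-foldl (spliceQ P (suc k)) ms (twoTopped-spliceQ P two k) 3≤ms

twoTopped-splice : ∀ W → W ≢ [] → All (3 ≤_) W → TwoTopped (splice W)
twoTopped-splice []                W≢[] _ = ⊥-elim (W≢[] refl)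
twoTopped-splice (.(3 + k) ∷ ns) _ (s≤s (s≤s (s≤s {n = k} _)) ∷ 3≤ns) =
  twoTopped-foldl (Q′ (suc k)) ns (twoTopped-Q′ k) 3≤ns

splice-∷ʳ-tower : ∀ ini → All (3 ≤_) ini → QTower (λ k → splice (ini ∷ʳ (2 + k)))
splice-∷ʳ-tower []         _     = Q′-tower
splice-∷ʳ-tower ini@(_ ∷ _) 3≤ini = QTower-cong (λ k → sym (splice-++ ini (2 + k ∷ []) (λ ())))
  (spliceQ-tower (splice ini) (twoTopped-splice ini (λ ()) 3≤ini))

spliceQ3s : SPoset → ℕ → SPoset
spliceQ3s P t = foldl spliceStep P (replicate t 3)

l∖p₁-spliceQ3s : ∀ t P → TwoTopped P → l∖p₁ (spliceQ3s P t) ≡ l∖p₁ P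
l∖p₁-spliceQ3s zero    P two = refl
l∖p₁-spliceQ3s (suc t) P two =
  trans (l∖p₁-spliceQ3s t (spliceQ P 1) (twoTopped-spliceQ P two 0)) (spliceQ₁-l∖p₁ P two)

l-spliceQ3s : ∀ t P → TwoTopped P → l (spliceQ3s P t) ≡ l P + t * l∖p₁ P
l-spliceQ3s zero    P two = sym (+-identityʳ (l P))
l-spliceQ3s (suc t) P two = begin
  l (spliceQ3s (spliceQ P 1) t)
    ≡⟨ l-spliceQ3s t (spliceQ P 1) two′ ⟩
  l (spliceQ P 1) + t * l∖p₁ (spliceQ P 1)
    ≡⟨ cong₂ (λ a b → a + t * b) (spliceQ₁-l P two) (spliceQ₁-l∖p₁ P two) ⟩
  l P + l∖p₁ P + t * l∖p₁ P
    ≡⟨ +-assoc (l P) (l∖p₁ P) (t * l∖p₁ P) ⟩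
  l P + suc t * l∖p₁ P  ∎
  where
  open ≡-Reasoning
  two′ = twoTopped-spliceQ P two 0

size-spliceQ3s : ∀ t P → size (spliceQ3s P t) ≡ size P + t
size-spliceQ3s zero    P = sym (+-identityʳ (size P))
size-spliceQ3s (suc t) P = trans (size-spliceQ3s t (spliceQ P 1)) (+-assoc (size P) 1 t)

All≡⇒replicate : ∀ {x} (xs : List ℕ) → All (_≡ x) xs → xs ≡ replicate (length xs) x
All≡⇒replicate []       []           = refl
All≡⇒replicate (y ∷ xs) (refl ∷ ≡xs) = cong (y ∷_) (All≡⇒replicate xs ≡xs)

l-splice-∷ʳ : ∀ ini m → All (3 ≤_) (ini ∷ʳ m) →
  l (splice (ini ∷ʳ m)) ≡ l (splice (ini ∷ʳ (m ∸ 1))) + l∖p₁ (splice (ini ∷ʳ m))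
l-splice-∷ʳ ini m 3≤ini∷ʳm with ∷ʳ⁻ 3≤ini∷ʳm
... | 3≤ini , s≤s (s≤s (s≤s {n = k} _)) = QTower.l-suc (splice-∷ʳ-tower ini 3≤ini) k

∷ʳ-≢[] : ∀ (W : List ℕ) m → W ∷ʳ m ≢ []
∷ʳ-≢[] []      m ()
∷ʳ-≢[] (_ ∷ _) m ()

l∖p₁-splice : ∀ pre nr post → All (3 ≤_) pre → 4 ≤ nr → All (_≡ 3) post →
  l∖p₁ (splice (pre ++ nr ∷ post)) ≡ l (splice (pre ∷ʳ (nr ∸ 2)))
l∖p₁-splice pre .(4 + j) post 3≤pre (s≤s (s≤s (s≤s (s≤s {n = j} _)))) ≡3 = begin
  l∖p₁ (splice (pre ++ (4 + j) ∷ post))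
    ≡⟨ cong (l∖p₁ ∘ splice) (sym (++-assoc pre (4 + j ∷ []) post)) ⟩
  l∖p₁ (splice (prefix ++ post))
    ≡⟨ cong l∖p₁ (splice-++ prefix post (∷ʳ-≢[] pre (4 + j))) ⟩
  l∖p₁ (foldl spliceStep (splice prefix) post)
    ≡⟨ cong (λ ms → l∖p₁ (foldl spliceStep (splice prefix) ms)) (All≡⇒replicate post ≡3) ⟩
  l∖p₁ (spliceQ3s (splice prefix) (length post))
    ≡⟨ l∖p₁-spliceQ3s (length post) (splice prefix) (QTower.twoTopped tower (suc j)) ⟩
  l∖p₁ (splice prefix)
    ≡⟨ QTower.l∖p₁-suc² tower j ⟩
  l (splice (pre ∷ʳ (2 + j)))  ∎
  where
  open ≡-Reasoning
  prefix = pre ∷ʳ (4 + j)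
  tower = splice-∷ʳ-tower pre 3≤pre

l-splice-threes : ∀ ns → ns ≢ [] → All (_≡ 3) ns → l (splice ns) ≡ size (splice ns)
l-splice-threes []       ns≢[] _  = ⊥-elim (ns≢[] refl)
l-splice-threes (3 ∷ ns) _     (refl ∷ ≡3) rewrite All≡⇒replicate ns ≡3 = begin
  l (spliceQ3s (Q 3) t)              ≡⟨ l-spliceQ3s t (Q 3) (twoTopped-Q′ 0) ⟩
  3 + t * 1                             ≡⟨ cong (3 +_) (*-identityʳ t) ⟩
  3 + t                                 ≡⟨ size-spliceQ3s t (Q 3) ⟨
  size (spliceQ3s (Q 3) t)           ∎
  where
  open ≡-Reasoning
  t = length ns

proposition8p2 : (ns : List ℕ) → ns ≢ [] → All (3 ≤_) ns →
    (All (_≡ 3) ns → l (splice ns) ≡ size (splice ns))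
    × ((pre : List ℕ) (nr : ℕ) (post : List ℕ) → ns ≡ pre ++ (nr ∷ post) →
       4 ≤ nr → All (_≡ 3) post →
       (ini : List ℕ) (nlast : ℕ) → ns ≡ ini ∷ʳ nlast →
       l (splice ns) ≡ l (splice (ini ∷ʳ (nlast ∸ 1))) + l (splice (pre ∷ʳ (nr ∸ 2))))
proposition8p2 ns ns≢[] 3≤ns = l-splice-threes ns ns≢[] , recursion
  where
  recursion : (pre : List ℕ) (nr : ℕ) (post : List ℕ) → ns ≡ pre ++ (nr ∷ post) →
    4 ≤ nr → All (_≡ 3) post → (ini : List ℕ) (nlast : ℕ) → ns ≡ ini ∷ʳ nlast →
    l (splice ns) ≡ l (splice (ini ∷ʳ (nlast ∸ 1))) + l (splice (pre ∷ʳ (nr ∸ 2)))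
  recursion pre nr post ns≡pre++ 4≤nr ≡3 ini nlast ns≡ini∷ʳ = begin
    l (splice ns)
      ≡⟨ cong (l ∘ splice) ns≡ini∷ʳ ⟩
    l (splice (ini ∷ʳ nlast))
      ≡⟨ l-splice-∷ʳ ini nlast (subst (All (3 ≤_)) ns≡ini∷ʳ 3≤ns) ⟩
    l (splice (ini ∷ʳ (nlast ∸ 1))) + l∖p₁ (splice (ini ∷ʳ nlast))
      ≡⟨ cong (λ W → l (splice (ini ∷ʳ (nlast ∸ 1))) + l∖p₁ (splice W)) (trans (sym ns≡ini∷ʳ) ns≡pre++) ⟩
    l (splice (ini ∷ʳ (nlast ∸ 1))) + l∖p₁ (splice (pre ++ nr ∷ post))
      ≡⟨ cong (l (splice (ini ∷ʳ (nlast ∸ 1))) +_) (l∖p₁-splice pre nr post 3≤pre 4≤nr ≡3) ⟩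
    l (splice (ini ∷ʳ (nlast ∸ 1))) + l (splice (pre ∷ʳ (nr ∸ 2)))  ∎
    where
    open ≡-Reasoning
    3≤pre = ++⁻ˡ pre (subst (All (3 ≤_)) ns≡pre++ 3≤ns)
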